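{- (Topological representation theorem for EDC-lattices.) Let $\underline D=(D,\le,0,1,+,\cdot,C,\widehat C,\ll)$ be an EDC-lattice. Then: (i) there exist a topological space $X$ and an embedding of $\underline D$ into the EDC-lattice $RC(X)$ of regular closed subsets of $X$; (ii) there exist a topological space $Y$ and an embedding of $\underline D$ into the EDC-lattice $RO(Y)$ of regular open subsets of $Y$.
   Context: An EDC-lattice is a structure $(D,\le,0,1,+,\cdot,C,\widehat C,\ll)$ where $(D,\le,0,1,+,\cdot)$ is a bounded distributive lattice and $C,\widehat C,\ll$ are binary relations on $D$ such that for all $a,a',b,b',c,d\in D$ (writing $\overline R$ for the complement of a relation $R$): (C1) $aCb\Rightarrow a\neq0,b\ne 0$; (C2) $aCb$, $a\le a'$, $b\le b'\Rightarrow a'Cb'$; (C3) $aC(b+c)\Rightarrow aCb$ or $aCc$; (C4) $aCb\Rightarrow bCa$; (C5) $a\cdot b\ne0\Rightarrow aCb$; ($\widehat C$1) $a\widehat Cb\Rightarrow a\ne1,b\ne1$; ($\widehat C$2) $a\widehat Cb$, $a'\le a$, $b'\le b\Rightarrow a'\widehat Cb'$; ($\widehat C$3) $a\widehat C(b\cdot c)\Rightarrow a\widehat Cb$ or $a\widehat Cc$; ($\widehat C$4) $a\widehat Cb\Rightarrow b\widehat Ca$; ($\widehat C$5) $a+b\ne1\Rightarrow a\widehat Cb$; ($\ll$1) $0\ll0$; ($\ll$2) $1\ll1$; ($\ll$3) $a\ll b\Rightarrow a\le b$; ($\ll$4) $a'\le a\ll b\le b'\Rightarrow a'\ll b'$;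 ($\ll$5) $a\ll c$, $b\ll c\Rightarrow a+b\ll c$; ($\ll$6) $c\ll a$, $c\ll b\Rightarrow c\ll a\cdot b$; ($\ll$7) $a\ll b$, $b\cdot c\ll d$, $c\ll a+d\Rightarrow c\ll d$; (MC1) $aCb$, $a\ll c\Rightarrow aC(b\cdot c)$; (MC2) $a\overline C(b\cdot c)$, $aCb$, $(a\cdot d)\overline Cb\Rightarrow d\widehat Cc$; (M$\widehat C$1) $a\widehat Cb$, $c\ll a\Rightarrow a\widehat C(b+c)$; (M$\widehat C$2) $a\overline{\widehat C}(b+c)$, $a\widehat Cb$, $(a+d)\overline{\widehat C}b\Rightarrow dCc$; (M$\ll$1) $a\overline{\widehat C}b$, $a\cdot c\ll b\Rightarrow c\ll b$; (M$\ll$2) $a\overline Cb$, $b\ll a+c\Rightarrow b\ll c$. For a topological space $X$ with closure $Cl$ and interior $Int$: $RC(X)$ is the set of regular closed sets ($a=Cl(Int(a))$) with $\le=\subseteq$, $0=\varnothing$, $1=X$, $a+b=a\cup b$, $a\cdot b=Cl(Int(a\cap b))$, $aCb$ iff $a\cap b\ne\varnothing$, $a\widehat Cb$ iff $Int(a)\cup Int(b)\neq X$, $a\ll b$ iff $a\subseteq Int(b)$. $RO(X)$ is the set of regular open sets ($a=Int(Cl(a))$) with $\le=\subseteq$, $0=\varnothing$, $1=X$, $a\cdot b=a\cap b$, $a+b=Int(Cl(a\cup b))$, $aCb$ iff $Cl(a)\cap Cl(b)\ne\varnothing$, $a\widehat Cb$ iff $a\cup b\ne X$, $a\ll b$ iff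 $Cl(a)\subseteq b$. An embedding of EDC-lattices is an injective map preserving $0,1,+,\cdot$ such that $aCb\iff h(a)Ch(b)$, $a\widehat Cb\iff h(a)\widehat Ch(b)$, $a\ll b\iff h(a)\ll h(b)$. -}

module Defs where

open import Level using (Level; 0ℓ) renaming (suc to lsuc)
open import Data.Product using (Σ; ∃; _×_; _,_)
open import Data.Sum using (_⊎_)
open import Relation.Nullary using (¬_)
open import Relation.Binary.PropositionalEquality using (_≡_)
open import Relation.Unary using (Pred; _⊆_; _≐_; _∩_; _∪_; ∅; U)
import Algebra.Lattice.Structures as LS

-- Classical foundations (the paper works in ZFC): Zorn's lemma, stated
-- for preordered sets (maximal element m: m ≤ x implies x ≤ m).

Zorn : ∀ ℓ → Set (lsuc ℓ)
Zorn ℓ = (P : Set ℓ) (_≤_ : P → P → Set ℓ) →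
         (∀ x → x ≤ x) → (∀ x y z → x ≤ y → y ≤ z → x ≤ z) →
         ((S : Pred P ℓ) → (∀ x y → S x → S y → x ≤ y ⊎ y ≤ x) →
            Σ P (λ u → ∀ x → S x → x ≤ u)) →
         Σ P (λ m → ∀ x → m ≤ x → x ≤ m)

record EDCLattice : Set₁ where
  infix  4 _≤_ _C_ _Ĉ_ _≪_
  infixl 6 _+_
  infixl 7 _·_
  field
    D   : Set
    _≤_ : D → D → Set
    𝟘 𝟙 : D
    _+_ _·_ : D → D → D
    _C_ _Ĉ_ _≪_ : D → D → Set
    isDistributiveLattice : LS.IsDistributiveLattice {A = D} _≡_ _+_ _·_
    ≤⇒+ : ∀ {a b} → a ≤ b → a + b ≡ b
    +⇒≤ : ∀ {a b} → a + b ≡ b → a ≤ b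
    𝟘-least : ∀ a → 𝟘 ≤ a
    𝟙-greatest : ∀ a → a ≤ 𝟙
    C1 : ∀ {a b} → a C b → ¬ (a ≡ 𝟘) × ¬ (b ≡ 𝟘)
    C2 : ∀ {a a' b b'} → a C b → a ≤ a' → b ≤ b' → a' C b'
    C3 : ∀ {a b c} → a C (b + c) → a C b ⊎ a C c
    C4 : ∀ {a b} → a C b → b C a
    C5 : ∀ {a b} → ¬ (a · b ≡ 𝟘) → a C b
    Ĉ1 : ∀ {a b} → a Ĉ b → ¬ (a ≡ 𝟙) × ¬ (b ≡ 𝟙)
    Ĉ2 : ∀ {a a' b b'} → a Ĉ b → a' ≤ a → b' ≤ b → a' Ĉ b'
    Ĉ3 : ∀ {a b c} → a Ĉ (b · c) → a Ĉ b ⊎ a Ĉ c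
    Ĉ4 : ∀ {a b} → a Ĉ b → b Ĉ a
    Ĉ5 : ∀ {a b} → ¬ (a + b ≡ 𝟙) → a Ĉ b
    ≪1 : 𝟘 ≪ 𝟘
    ≪2 : 𝟙 ≪ 𝟙
    ≪3 : ∀ {a b} → a ≪ b → a ≤ b
    ≪4 : ∀ {a a' b b'} → a' ≤ a → a ≪ b → b ≤ b' → a' ≪ b'
    ≪5 : ∀ {a b c} → a ≪ c → b ≪ c → a + b ≪ c
    ≪6 : ∀ {a b c} → c ≪ a → c ≪ b → c ≪ a · b
    ≪7 : ∀ {a b c d} → a ≪ b → b · c ≪ d → c ≪ a + d → c ≪ d
    MC1 : ∀ {a b c} → a C b → a ≪ c → a C (b · c)
    MC2 : ∀ {a b c d} → ¬ (a C (b · c)) → a C b → ¬ ((a · d) C b) → d Ĉ c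
    MĈ1 : ∀ {a b c} → a Ĉ b → c ≪ a → a Ĉ (b + c)
    MĈ2 : ∀ {a b c d} → ¬ (a Ĉ (b + c)) → a Ĉ b → ¬ ((a + d) Ĉ b) → d C c
    M≪1 : ∀ {a b c} → ¬ (a Ĉ b) → a · c ≪ b → c ≪ b
    M≪2 : ∀ {a b c} → ¬ (a C b) → b ≪ a + c → b ≪ c

-- The topology is presented as a set `Open` of
-- (codes of) open sets with their extensions ⟦_⟧, closed under
-- arbitrary unions and finite intersections (whole space included).

record Topology (X : Set) : Set₁ where
  field
    Open  : Set
    ⟦_⟧   : Open → Pred X 0ℓ
    ⋃-open : (I : Set) (f : I → Open) →
             Σ Open (λ o → ⟦ o ⟧ ≐ (λ x → ∃ (λ i → ⟦ f i ⟧ x)))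
    ∩-open : (o o' : Open) → Σ Open (λ o'' → ⟦ o'' ⟧ ≐ (⟦ o ⟧ ∩ ⟦ o' ⟧))
    U-open : Σ Open (λ o → ⟦ o ⟧ ≐ U)

  Int : Pred X 0ℓ → Pred X 0ℓ
  Int A x = Σ Open (λ o → ⟦ o ⟧ x × ⟦ o ⟧ ⊆ A)

  Cl : Pred X 0ℓ → Pred X 0ℓ
  Cl A x = ∀ o → ⟦ o ⟧ x → ∃ (λ y → ⟦ o ⟧ y × A y)

  RegularClosed : Pred X 0ℓ → Set
  RegularClosed A = A ≐ Cl (Int A)

  RegularOpen : Pred X 0ℓ → Set
  RegularOpen A = A ≐ Int (Cl A)

-- Embeddings of an EDC-lattice into RC(X) and RO(X).
-- Elements of RC(X) / RO(X) are subsets, equal when extensionally equal (≐).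

record EmbeddingRC (L : EDCLattice) {X : Set} (τ : Topology X) : Set₁ where
  open EDCLattice L
  open Topology τ
  field
    h          : D → Pred X 0ℓ
    h-regular  : ∀ a → RegularClosed (h a)
    h-injective : ∀ a b → h a ≐ h b → a ≡ b
    h-𝟘 : h 𝟘 ≐ ∅
    h-𝟙 : h 𝟙 ≐ U
    h-+ : ∀ a b → h (a + b) ≐ (h a ∪ h b)
    h-· : ∀ a b → h (a · b) ≐ Cl (Int (h a ∩ h b))
    h-C⇒ : ∀ a b → a C b → ¬ ((h a ∩ h b) ≐ ∅)
    h-C⇐ : ∀ a b → ¬ ((h a ∩ h b) ≐ ∅) → a C b
    h-Ĉ⇒ : ∀ a b → a Ĉ b → ¬ ((Int (h a) ∪ Int (h b)) ≐ U)
    h-Ĉ⇐ : ∀ a b → ¬ ((Int (h a) ∪ Int (h b)) ≐ U) → a Ĉ b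
    h-≪⇒ : ∀ a b → a ≪ b → h a ⊆ Int (h b)
    h-≪⇐ : ∀ a b → h a ⊆ Int (h b) → a ≪ b

record EmbeddingRO (L : EDCLattice) {Y : Set} (τ : Topology Y) : Set₁ where
  open EDCLattice L
  open Topology τ
  field
    h          : D → Pred Y 0ℓ
    h-regular  : ∀ a → RegularOpen (h a)
    h-injective : ∀ a b → h a ≐ h b → a ≡ b
    h-𝟘 : h 𝟘 ≐ ∅
    h-𝟙 : h 𝟙 ≐ U
    h-+ : ∀ a b → h (a + b) ≐ Int (Cl (h a ∪ h b))
    h-· : ∀ a b → h (a · b) ≐ (h a ∩ h b)
    h-C⇒ : ∀ a b → a C b → ¬ ((Cl (h a) ∩ Cl (h b)) ≐ ∅)
    h-C⇐ : ∀ a b → ¬ ((Cl (h a) ∩ Cl (h b)) ≐ ∅) → a C b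
    h-Ĉ⇒ : ∀ a b → a Ĉ b → ¬ ((h a ∪ h b) ≐ U)
    h-Ĉ⇐ : ∀ a b → ¬ ((h a ∪ h b) ≐ U) → a Ĉ b
    h-≪⇒ : ∀ a b → a ≪ b → Cl (h a) ⊆ h b
    h-≪⇐ : ∀ a b → Cl (h a) ⊆ h b → a ≪ b

{-# OPTIONS --safe #-}
-- The points of the representing space are the prime filters of L together with one "edge"
-- for each pair of prime filters x, y related by the canonical relation Linked x y.  The open
-- sets are the up-sets of the order in which an edge lies below its two end points.  An element
-- a is sent to the set of points one of whose prime filters contains a; it is regular closed,
-- with interior the set of points all of whose prime filters contain a.  The lattice operations
-- are preserved because prime filters are prime, and C, Ĉ, ≪ by the definition of Linked.  They
-- are reflected because every failure is witnessed by a linked pair: a prime filter x maximal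
-- for the failing property (Zorn's lemma) determines, through the mixed axioms, a filter and an
-- ideal which the prime filter theorem separates by the partner y.  The Ĉ case is the C case
-- of the order-dual lattice, and a ↦ Int (h a) embeds L into the regular open sets.

module Submission where

open import Defs
open import Level using (0ℓ; Lift; lift) renaming (suc to lsuc)
open import Data.Bool using (Bool; true; T; _∧_)
open import Data.Bool.Properties using (T-∧)
open import Data.Empty using (⊥; ⊥-elim)
open import Data.Product using (Σ; ∃; ∃₂; _×_; _,_; proj₁; proj₂)
import Data.Product as Product
open import Data.Sum using (_⊎_; inj₁; inj₂; [_,_])
import Data.Sum as Sum
open import Data.Unit using (tt)
open import Function using (Equivalence; flip; _∘_; id)
open import Relation.Binary.PropositionalEquality using (_≡_; refl; sym; cong; subst; isEquivalence; module ≡-Reasoning)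
open import Relation.Nullary using (¬_; yes; no)
open import Relation.Nullary.Decidable using (isYes; toWitness; fromWitness)
open import Relation.Unary using (Pred; _⊆_; _≐_; _∩_; _∪_; U; ∁)
open import Relation.Unary.Properties using (≐-sym; ≐-trans)
open import Axiom.ExcludedMiddle using (ExcludedMiddle)
open import Axiom.DoubleNegationElimination using (em⇒dne)
import Algebra.Lattice.Bundles as AlgBundles
import Algebra.Lattice.Properties.Lattice as AlgLatticeProperties
import Algebra.Lattice.Properties.DistributiveLattice as AlgDistributiveLatticeProperties
import Algebra.Lattice.Structures as AlgStructures
import Relation.Binary.Lattice as OrderLattice
import Relation.Binary.Lattice.Properties.JoinSemilattice as JoinSemilatticeProperties
import Relation.Binary.Lattice.Properties.MeetSemilattice as MeetSemilatticeProperties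
import Relation.Binary.Reasoning.PartialOrder as PartialOrderReasoning

module Classical (em : ExcludedMiddle 0ℓ) where

  decide : Set → Bool
  decide A = isYes (em {A})

  decide-sound : {A : Set} → T (decide A) → A
  decide-sound = toWitness

  decide-complete : {A : Set} → A → T (decide A)
  decide-complete = fromWitness

  dne : {A : Set} → ¬ ¬ A → A
  dne = em⇒dne em

module LatticeOrder (L : EDCLattice) where
  open EDCLattice L
  open AlgStructures.IsDistributiveLattice isDistributiveLattice
    using (isLattice; ∨-comm; ∧-comm; ∧-absorbs-∨; ∨-absorbs-∧; ∧-distribˡ-∨)

  private
    algebraicLattice : AlgBundles.Lattice 0ℓ 0ℓ
    algebraicLattice = record
      { Carrier = D ; _≈_ = _≡_ ; _∨_ = _+_ ; _∧_ = _·_ ; isLattice = isLattice }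

    module N = OrderLattice.IsLattice
      (AlgLatticeProperties.∨-∧-isOrderTheoreticLattice algebraicLattice)

    ≤⇒≤ₙ : ∀ {a b} → a ≤ b → a ≡ a · b
    ≤⇒≤ₙ {a} {b} a≤b = begin
      a            ≡⟨ sym (∧-absorbs-∨ a b) ⟩
      a · (a + b)  ≡⟨ cong (a ·_) (≤⇒+ a≤b) ⟩
      a · b        ∎
      where open ≡-Reasoning

    ≤ₙ⇒≤ : ∀ {a b} → a ≡ a · b → a ≤ b
    ≤ₙ⇒≤ {a} {b} a≡a·b = +⇒≤ (begin
      a + b      ≡⟨ cong (_+ b) a≡a·b ⟩
      a · b + b  ≡⟨ ∨-comm (a · b) b ⟩
      b + a · b  ≡⟨ cong (b +_) (∧-comm a b) ⟩
      b + b · a  ≡⟨ ∨-absorbs-∧ b a ⟩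
      b          ∎)
      where open ≡-Reasoning

  orderLattice : OrderLattice.Lattice 0ℓ 0ℓ 0ℓ
  orderLattice = record
    { Carrier = D ; _≈_ = _≡_ ; _≤_ = _≤_ ; _∨_ = _+_ ; _∧_ = _·_
    ; isLattice = record
      { isPartialOrder = record
        { isPreorder = record
          { isEquivalence = isEquivalence
          ; reflexive = λ a≡b → ≤ₙ⇒≤ (N.reflexive a≡b)
          ; trans = λ a≤b b≤c → ≤ₙ⇒≤ (N.trans (≤⇒≤ₙ a≤b) (≤⇒≤ₙ b≤c))
          }
        ; antisym = λ a≤b b≤a → N.antisym (≤⇒≤ₙ a≤b) (≤⇒≤ₙ b≤a)
        }
      ; supremum = λ a b → ≤ₙ⇒≤ (N.x≤x∨y a b) , ≤ₙ⇒≤ (N.y≤x∨y a b) ,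
          λ c a≤c b≤c → ≤ₙ⇒≤ (N.∨-least (≤⇒≤ₙ a≤c) (≤⇒≤ₙ b≤c))
      ; infimum = λ a b → ≤ₙ⇒≤ (N.x∧y≤x a b) , ≤ₙ⇒≤ (N.x∧y≤y a b) ,
          λ c c≤a c≤b → ≤ₙ⇒≤ (N.∧-greatest (≤⇒≤ₙ c≤a) (≤⇒≤ₙ c≤b))
      }
    }

  open OrderLattice.Lattice orderLattice public
    using (x≤x∨y; y≤x∨y; ∨-least; x∧y≤x; x∧y≤y; ∧-greatest)
    renaming (refl to ≤-refl; reflexive to ≤-reflexive; trans to ≤-trans; antisym to ≤-antisym)
  open JoinSemilatticeProperties (OrderLattice.Lattice.joinSemilattice orderLattice) public
    using (∨-monotonic)
  open MeetSemilatticeProperties (OrderLattice.Lattice.meetSemilattice orderLattice) public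
    using (∧-monotonic; y≤x⇒x∧y≈y)
  module ≤-Reasoning = PartialOrderReasoning (OrderLattice.Lattice.poset orderLattice)

  ·-distribˡ-+ : ∀ a b c → a · (b + c) ≤ a · b + a · c
  ·-distribˡ-+ a b c = ≤-reflexive (∧-distribˡ-∨ a b c)

  ·-comm-≤ : ∀ a b → a · b ≤ b · a
  ·-comm-≤ a b = ≤-reflexive (∧-comm a b)

  +𝟘-≤ : ∀ a → a + 𝟘 ≤ a
  +𝟘-≤ a = ∨-least ≤-refl (𝟘-least a)

  ≤𝟙· : ∀ a → a ≤ 𝟙 · a
  ≤𝟙· a = ∧-greatest (𝟙-greatest a) ≤-refl

module Filters (L : EDCLattice) where
  open EDCLattice L
  open LatticeOrder L

  record IsFilter (F : Pred D 0ℓ) : Set where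
    field
      up-closed : ∀ {a b} → F a → a ≤ b → F b
      ·-closed  : ∀ {a b} → F a → F b → F (a · b)
      has-𝟙     : F 𝟙

  record IsIdeal (I : Pred D 0ℓ) : Set where
    field
      down-closed : ∀ {a b} → I b → a ≤ b → I a
      +-closed    : ∀ {a b} → I a → I b → I (a + b)
      has-𝟘       : I 𝟘

  record IsPrimeFilter (P : Pred D 0ℓ) : Set where
    field
      isFilter : IsFilter P
      proper   : ¬ P 𝟘
      prime    : ∀ {a b} → P (a + b) → P a ⊎ P b
    open IsFilter isFilter public

  IsPrimeFilter-resp-≐ : ∀ {P Q} → P ≐ Q → IsPrimeFilter P → IsPrimeFilter Q
  IsPrimeFilter-resp-≐ (P⊆Q , Q⊆P) isPF = record
    { isFilter = record
      { up-closed = λ Qa a≤b → P⊆Q (up-closed (Q⊆P Qa) a≤b)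
      ; ·-closed  = λ Qa Qb → P⊆Q (·-closed (Q⊆P Qa) (Q⊆P Qb))
      ; has-𝟙     = P⊆Q has-𝟙
      }
    ; proper = λ Q𝟘 → proper (Q⊆P Q𝟘)
    ; prime  = λ Qa+b → Sum.map P⊆Q P⊆Q (prime (Q⊆P Qa+b))
    }
    where open IsPrimeFilter isPF

  infix 9 ↑_ ↓_
  infixl 5 _∨ᶠ_ _∨ⁱ_

  ↑_ : D → Pred D 0ℓ
  ↑ a = a ≤_

  ↓_ : D → Pred D 0ℓ
  ↓ a = _≤ a

  ↑-isFilter : ∀ a → IsFilter (↑ a)
  ↑-isFilter a = record
    { up-closed = ≤-trans
    ; ·-closed  = ∧-greatest
    ; has-𝟙     = 𝟙-greatest a
    }

  ↓-isIdeal : ∀ a → IsIdeal (↓ a)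
  ↓-isIdeal a = record
    { down-closed = flip ≤-trans
    ; +-closed    = ∨-least
    ; has-𝟘       = 𝟘-least a
    }

  _∨ᶠ_ : Pred D 0ℓ → Pred D 0ℓ → Pred D 0ℓ
  (F ∨ᶠ G) d = ∃₂ λ f g → F f × G g × f · g ≤ d

  _∨ⁱ_ : Pred D 0ℓ → Pred D 0ℓ → Pred D 0ℓ
  (I ∨ⁱ J) d = ∃₂ λ i j → I i × J j × d ≤ i + j

  module _ {F G : Pred D 0ℓ} (F-filter : IsFilter F) (G-filter : IsFilter G) where
    open IsFilter

    ∨ᶠ-isFilter : IsFilter (F ∨ᶠ G)
    ∨ᶠ-isFilter = record
      { up-closed = λ (f , g , Ff , Gg , fg≤d) d≤d' → f , g , Ff , Gg , ≤-trans fg≤d d≤d'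
      ; ·-closed  = λ (f , g , Ff , Gg , fg≤d) (f' , g' , Ff' , Gg' , f'g'≤d') →
          f · f' , g · g' , ·-closed F-filter Ff Ff' , ·-closed G-filter Gg Gg' ,
          ∧-greatest (≤-trans (∧-monotonic (x∧y≤x f f') (x∧y≤x g g')) fg≤d)
                     (≤-trans (∧-monotonic (x∧y≤y f f') (x∧y≤y g g')) f'g'≤d')
      ; has-𝟙     = 𝟙 , 𝟙 , has-𝟙 F-filter , has-𝟙 G-filter , x∧y≤x 𝟙 𝟙
      }

    ∨ᶠ-inj₁ : F ⊆ F ∨ᶠ G
    ∨ᶠ-inj₁ {f} Ff = f , 𝟙 , Ff , has-𝟙 G-filter , x∧y≤x f 𝟙

    ∨ᶠ-inj₂ : G ⊆ F ∨ᶠ G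
    ∨ᶠ-inj₂ {g} Gg = 𝟙 , g , has-𝟙 F-filter , Gg , x∧y≤y 𝟙 g

  module _ {I J : Pred D 0ℓ} (I-ideal : IsIdeal I) (J-ideal : IsIdeal J) where
    open IsIdeal

    ∨ⁱ-isIdeal : IsIdeal (I ∨ⁱ J)
    ∨ⁱ-isIdeal = record
      { down-closed = λ (i , j , Ii , Jj , d≤ij) d'≤d → i , j , Ii , Jj , ≤-trans d'≤d d≤ij
      ; +-closed    = λ (i , j , Ii , Jj , d≤ij) (i' , j' , Ii' , Jj' , d'≤i'j') →
          i + i' , j + j' , +-closed I-ideal Ii Ii' , +-closed J-ideal Jj Jj' ,
          ∨-least (≤-trans d≤ij (∨-monotonic (x≤x∨y i i') (x≤x∨y j j')))
                  (≤-trans d'≤i'j' (∨-monotonic (y≤x∨y i i') (y≤x∨y j j')))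
      ; has-𝟘       = 𝟘 , 𝟘 , has-𝟘 I-ideal , has-𝟘 J-ideal , 𝟘-least (𝟘 + 𝟘)
      }

    ∨ⁱ-inj₁ : I ⊆ I ∨ⁱ J
    ∨ⁱ-inj₁ {i} Ii = i , 𝟘 , Ii , has-𝟘 J-ideal , x≤x∨y i 𝟘

    ∨ⁱ-inj₂ : J ⊆ I ∨ⁱ J
    ∨ⁱ-inj₂ {j} Jj = 𝟘 , j , has-𝟘 I-ideal , Jj , y≤x∨y 𝟘 j

  -- Prime filters are coded by Bool-valued membership so that they form a Set.
  record PrimeFilter : Set where
    field
      contains      : D → Bool
      isPrimeFilter : IsPrimeFilter (λ a → T (contains a))
    open IsPrimeFilter isPrimeFilter public

  infix 4 _∋_
  _∋_ : PrimeFilter → D → Set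
  x ∋ a = T (PrimeFilter.contains x a)

  open PrimeFilter public using (up-closed; ·-closed; has-𝟙; proper; prime)

  ∋-· : ∀ x {a b} → x ∋ a · b → x ∋ a × x ∋ b
  ∋-· x {a} {b} x∋ab = up-closed x x∋ab (x∧y≤x a b) , up-closed x x∋ab (x∧y≤y a b)

  ∋⇒C : ∀ x {a b} → x ∋ a → x ∋ b → a C b
  ∋⇒C x x∋a x∋b = C5 λ a·b≡𝟘 → proper x (subst (x ∋_) a·b≡𝟘 (·-closed x x∋a x∋b))

  ∌⇒Ĉ : ∀ x {a b} → ¬ x ∋ a → ¬ x ∋ b → a Ĉ b
  ∌⇒Ĉ x x∌a x∌b = Ĉ5 λ a+b≡𝟙 → [ x∌a , x∌b ] (prime x (subst (x ∋_) (sym a+b≡𝟙) (has-𝟙 x)))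

  record PrimeSeparator (F I : Pred D 0ℓ) : Set where
    field
      filter  : PrimeFilter
      extends : F ⊆ (filter ∋_)
      avoids  : ∀ {a} → filter ∋ a → ¬ I a
      maximal : ∀ {a} → ¬ filter ∋ a → ∃ λ r → filter ∋ r × I (r · a)

module PrimeFilterTheorem (em₀ : ExcludedMiddle 0ℓ) (em₁ : ExcludedMiddle (lsuc 0ℓ))
                          (zorn : Zorn (lsuc 0ℓ)) (L : EDCLattice) where
  open EDCLattice L
  open LatticeOrder L
  open Filters L
  open Classical em₀

  fromPred : (P : Pred D 0ℓ) → IsPrimeFilter P → PrimeFilter
  fromPred P isPF = record
    { contains      = λ a → decide (P a)
    ; isPrimeFilter = IsPrimeFilter-resp-≐ (decide-complete , decide-sound) isPF
    }

  -- Excluded middle one level up squashes a large proposition into Set.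
  private
    ∥_∥ : Set₁ → Set
    ∥ A ∥ = T (isYes (em₁ {A}))

    squash : {A : Set₁} → A → ∥ A ∥
    squash = fromWitness

    unsquash : {A : Set₁} → ∥ A ∥ → A
    unsquash {A} = toWitness {a? = em₁ {A}}

  module _ {F I : Pred D 0ℓ} (F-filter : IsFilter F) (I-ideal : IsIdeal I)
           (F∩I≡∅ : ∀ {a} → F a → ¬ I a) where

    private
      record Separating (G : Pred D 0ℓ) : Set where
        field
          isFilter : IsFilter G
          extends  : F ⊆ G
          avoids   : ∀ {a} → G a → ¬ I a

      Candidate : Set₁
      Candidate = Σ (Pred D 0ℓ) Separating

      _⊑_ : Candidate → Candidate → Set₁
      G ⊑ H = Lift (lsuc 0ℓ) (proj₁ G ⊆ proj₁ H)

      module Sep = Separating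
      module FI = IsFilter

      chain-bound : (chain : Pred Candidate (lsuc 0ℓ)) →
                    (∀ G H → chain G → chain H → G ⊑ H ⊎ H ⊑ G) →
                    Σ Candidate λ bound → ∀ G → chain G → G ⊑ bound
      chain-bound chain comparable =
        (⋃chain , separating) , λ G chainG → lift λ Ga → inj₂ (squash (G , chainG , Ga))
        where
        ⋃chain : Pred D 0ℓ
        ⋃chain d = F d ⊎ ∥ Σ Candidate (λ G → chain G × proj₁ G d) ∥

        common : ∀ {a b} → ⋃chain a → ⋃chain b →
                 (F a × F b) ⊎ Σ Candidate λ G → chain G × proj₁ G a × proj₁ G b
        common (inj₁ Fa) (inj₁ Fb) = inj₁ (Fa , Fb)
        common (inj₁ Fa) (inj₂ t) with unsquash t
        ... | G , chainG , Gb = inj₂ (G , chainG , Sep.extends (proj₂ G) Fa , Gb)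
        common (inj₂ t) (inj₁ Fb) with unsquash t
        ... | G , chainG , Ga = inj₂ (G , chainG , Ga , Sep.extends (proj₂ G) Fb)
        common (inj₂ t) (inj₂ t') with unsquash t | unsquash t'
        ... | G , chainG , Ga | H , chainH , Hb with comparable G H chainG chainH
        ...   | inj₁ (lift G⊆H) = inj₂ (H , chainH , G⊆H Ga , Hb)
        ...   | inj₂ (lift H⊆G) = inj₂ (G , chainG , Ga , H⊆G Hb)

        separating : Separating ⋃chain
        separating = record
          { isFilter = record
            { up-closed = λ where
                (inj₁ Fa) a≤b → inj₁ (FI.up-closed F-filter Fa a≤b)
                (inj₂ t) a≤b → let G , chainG , Ga = unsquash t in
                  inj₂ (squash (G , chainG , FI.up-closed (Sep.isFilter (proj₂ G)) Ga a≤b))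
            ; ·-closed = λ ⋃a ⋃b → [ (λ (Fa , Fb) → inj₁ (FI.·-closed F-filter Fa Fb))
                                   , (λ (G , chainG , Ga , Gb) →
                                        inj₂ (squash (G , chainG , FI.·-closed (Sep.isFilter (proj₂ G)) Ga Gb))) ]
                                   (common ⋃a ⋃b)
            ; has-𝟙 = inj₁ (FI.has-𝟙 F-filter)
            }
          ; extends = inj₁
          ; avoids = λ where
              (inj₁ Fa) → F∩I≡∅ Fa
              (inj₂ t) → let G , chainG , Ga = unsquash t in Sep.avoids (proj₂ G) Ga
          }

      maximal-candidate : Σ Candidate λ M → ∀ G → M ⊑ G → G ⊑ M
      maximal-candidate = zorn Candidate _⊑_ (λ _ → lift (λ Ga → Ga))
        (λ _ _ _ (lift G⊆H) (lift H⊆K) → lift (λ Ga → H⊆K (G⊆H Ga))) chain-bound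

      M : Pred D 0ℓ
      M = proj₁ (proj₁ maximal-candidate)

      M-separating : Separating M
      M-separating = proj₂ (proj₁ maximal-candidate)

      open Separating M-separating

      M-maximal : ∀ {p} → ¬ M p → ∃ λ r → M r × I (r · p)
      M-maximal {p} p∉M = dne λ no-witness →
        let M+p-separating : Separating (M ∨ᶠ ↑ p)
            M+p-separating = record
              { isFilter = ∨ᶠ-isFilter isFilter (↑-isFilter p)
              ; extends  = λ Fa → ∨ᶠ-inj₁ isFilter (↑-isFilter p) (extends Fa)
              ; avoids   = λ (r , g , Mr , p≤g , rg≤d) Id → no-witness
                  (r , Mr , IsIdeal.down-closed I-ideal Id (≤-trans (∧-monotonic ≤-refl p≤g) rg≤d))
              }
            lift M+p⊆M = proj₂ maximal-candidate (M ∨ᶠ ↑ p , M+p-separating)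
                           (lift (∨ᶠ-inj₁ isFilter (↑-isFilter p)))
        in p∉M (M+p⊆M (∨ᶠ-inj₂ isFilter (↑-isFilter p) ≤-refl))

      M-prime : ∀ {a b} → M (a + b) → M a ⊎ M b
      M-prime {a} {b} Ma+b with em₀ {M a} | em₀ {M b}
      ... | yes Ma | _ = inj₁ Ma
      ... | no _ | yes Mb = inj₂ Mb
      ... | no a∉M | no b∉M =
        let r , Mr , Ira = M-maximal a∉M
            r' , Mr' , Ir'b = M-maximal b∉M
            open ≤-Reasoning
            bound : (r · r') · (a + b) ≤ r · a + r' · b
            bound = begin
              (r · r') · (a + b)           ≤⟨ ·-distribˡ-+ (r · r') a b ⟩
              (r · r') · a + (r · r') · b  ≤⟨ ∨-monotonic (∧-monotonic (x∧y≤x r r') ≤-refl)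
                                                          (∧-monotonic (x∧y≤y r r') ≤-refl) ⟩
              r · a + r' · b               ∎
        in ⊥-elim (avoids (IsFilter.·-closed isFilter (IsFilter.·-closed isFilter Mr Mr') Ma+b)
                          (IsIdeal.down-closed I-ideal (IsIdeal.+-closed I-ideal Ira Ir'b) bound))

      M-isPrimeFilter : IsPrimeFilter M
      M-isPrimeFilter = record
        { isFilter = isFilter
        ; proper   = λ M𝟘 → avoids M𝟘 (IsIdeal.has-𝟘 I-ideal)
        ; prime    = M-prime
        }

    prime-filter-theorem : PrimeSeparator F I
    prime-filter-theorem = record
      { filter  = fromPred M M-isPrimeFilter
      ; extends = λ Fa → decide-complete (extends Fa)
      ; avoids  = λ x∋a → avoids (decide-sound x∋a)
      ; maximal = λ x∌a → let r , Mr , Ira = M-maximal (λ Ma → x∌a (decide-complete Ma))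
                          in r , decide-complete Mr , Ira
      }

module ContactLemmas (L : EDCLattice) where
  open EDCLattice L
  open LatticeOrder L

  C-split : ∀ {a w i j} → a C w → w ≤ i + j → a C (w · i) ⊎ a C (w · j)
  C-split {a} {w} {i} {j} aCw w≤i+j =
    C3 (C2 aCw ≤-refl (≤-trans (∧-greatest ≤-refl w≤i+j) (·-distribˡ-+ w i j)))

  C-≪ : ∀ {a b c} → a C b → b ≪ c → (a · c) C b
  C-≪ aCb b≪c = C4 (MC1 (C4 aCb) b≪c)

  -- By MC1 c contacts b · f₂ but, splitting along i₂ + i₁, not b · f₂ · f₁; MC2 concludes.
  Ĉ-core : ∀ {c b p t f₁ f₂ i₁ i₂} → c C b → c ≪ f₂ → ¬ (c · p) C b → ¬ (c · t) C b →
           ¬ c C i₁ → i₂ ≪ t → b · f₂ · f₁ ≤ i₂ + i₁ → p Ĉ f₁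
  Ĉ-core {c} {b} {p} {t} {f₁} {f₂} {i₁} {i₂} cCb c≪f₂ ¬cp-C-b ¬ct-C-b ¬cCi₁ i₂≪t w≤i₂+i₁ =
    MC2 ¬cCw (MC1 cCb c≪f₂) (λ cp-C-bf₂ → ¬cp-C-b (C2 cp-C-bf₂ ≤-refl (x∧y≤x b f₂)))
    where
    w = b · f₂ · f₁
    ¬cCw : ¬ c C w
    ¬cCw cCw with C-split cCw w≤i₂+i₁
    ... | inj₁ cCwi₂ = ¬ct-C-b (C2 (C-≪ cCwi₂ (≪4 (x∧y≤y w i₂) i₂≪t ≤-refl)) ≤-refl
                                   (≤-trans (x∧y≤x w i₂) (≤-trans (x∧y≤x _ f₁) (x∧y≤x b f₂))))
    ... | inj₂ cCwi₁ = ¬cCi₁ (C2 cCwi₁ ≤-refl (x∧y≤y w i₁))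

  -- M≪1 gives c ≪ f₁ + b, whence c ≪ i₂ + (i₁ + b); then ≪7 drops i₂ and M≪2 drops i₁.
  ≪-core : ∀ {c b p t f₁ f₂ i₁ i₂} → ¬ p Ĉ f₁ → c ≪ f₂ → c · p ≪ b → c · t ≪ b →
           ¬ c C i₁ → i₂ ≪ t → f₂ · f₁ ≤ i₂ + (i₁ + b) → c ≪ b
  ≪-core {c} {b} {p} {t} {f₁} {f₂} {i₁} {i₂} ¬pĈf₁ c≪f₂ cp≪b ct≪b ¬cCi₁ i₂≪t f₂f₁≤ =
    M≪2 (λ i₁Cc → ¬cCi₁ (C4 i₁Cc)) c≪i₁+b
    where
    c≪f₁+b : c ≪ f₁ + b
    c≪f₁+b = M≪1 (λ pĈf₁+b → ¬pĈf₁ (Ĉ2 pĈf₁+b ≤-refl (x≤x∨y f₁ b)))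
                 (≪4 (·-comm-≤ p c) cp≪b (y≤x∨y f₁ b))
    f₂[f₁+b]≤ : f₂ · (f₁ + b) ≤ i₂ + (i₁ + b)
    f₂[f₁+b]≤ = ≤-trans (·-distribˡ-+ f₂ f₁ b)
      (∨-least f₂f₁≤ (≤-trans (x∧y≤y f₂ b) (≤-trans (y≤x∨y i₁ b) (y≤x∨y i₂ (i₁ + b)))))
    c≪i₁+b : c ≪ i₁ + b
    c≪i₁+b = ≪7 i₂≪t (≪4 (·-comm-≤ t c) ct≪b (y≤x∨y i₁ b))
                (≪4 ≤-refl (≪6 c≪f₂ c≪f₁+b) f₂[f₁+b]≤)

module Canonical (em₀ : ExcludedMiddle 0ℓ) (em₁ : ExcludedMiddle (lsuc 0ℓ))
                 (zorn : Zorn (lsuc 0ℓ)) (L : EDCLattice) where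
  open EDCLattice L
  open LatticeOrder L
  open Filters L
  open PrimeFilterTheorem em₀ em₁ zorn L
  open ContactLemmas L
  open Classical em₀

  record Linked (x y : PrimeFilter) : Set where
    field
      C-link  : ∀ {a b} → x ∋ a → y ∋ b → a C b
      Ĉ-link  : ∀ {a b} → ¬ x ∋ a → ¬ y ∋ b → a Ĉ b
      ≪-forth : ∀ {a b} → a ≪ b → x ∋ a → y ∋ b
      ≪-back  : ∀ {a b} → a ≪ b → y ∋ a → x ∋ b

  -- Linked x y holds iff y contains the filters Γ-Ĉ x, Γ-≪ x and misses the ideals Δ-C x, Δ-≪ x.
  module _ (x : PrimeFilter) where
    Γ-Ĉ Γ-≪ Δ-C Δ-≪ : Pred D 0ℓ
    Γ-Ĉ f = ∃ λ p → ¬ x ∋ p × ¬ p Ĉ f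
    Γ-≪ f = ∃ λ q → x ∋ q × q ≪ f
    Δ-C i = ∃ λ r → x ∋ r × ¬ r C i
    Δ-≪ i = ∃ λ t → ¬ x ∋ t × i ≪ t

    Γ-Ĉ-isFilter : IsFilter Γ-Ĉ
    Γ-Ĉ-isFilter = record
      { up-closed = λ (p , x∌p , ¬pĈf) f≤f' → p , x∌p , λ pĈf' → ¬pĈf (Ĉ2 pĈf' ≤-refl f≤f')
      ; ·-closed  = λ (p , x∌p , ¬pĈf) (p' , x∌p' , ¬p'Ĉf') →
          p + p' , [ x∌p , x∌p' ] ∘ prime x ,
          [ (λ ĉ → ¬pĈf (Ĉ2 ĉ (x≤x∨y p p') ≤-refl))
          , (λ ĉ → ¬p'Ĉf' (Ĉ2 ĉ (y≤x∨y p p') ≤-refl)) ] ∘ Ĉ3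
      ; has-𝟙     = 𝟘 , proper x , λ 𝟘Ĉ𝟙 → proj₂ (Ĉ1 𝟘Ĉ𝟙) refl
      }

    Γ-≪-isFilter : IsFilter Γ-≪
    Γ-≪-isFilter = record
      { up-closed = λ (q , x∋q , q≪f) f≤f' → q , x∋q , ≪4 ≤-refl q≪f f≤f'
      ; ·-closed  = λ (q , x∋q , q≪f) (q' , x∋q' , q'≪f') →
          q · q' , ·-closed x x∋q x∋q' ,
          ≪6 (≪4 (x∧y≤x q q') q≪f ≤-refl) (≪4 (x∧y≤y q q') q'≪f' ≤-refl)
      ; has-𝟙     = 𝟙 , has-𝟙 x , ≪2
      }

    Δ-C-isIdeal : IsIdeal Δ-C
    Δ-C-isIdeal = record
      { down-closed = λ (r , x∋r , ¬rCi) i'≤i → r , x∋r , λ rCi' → ¬rCi (C2 rCi' ≤-refl i'≤i)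
      ; +-closed    = λ (r , x∋r , ¬rCi) (r' , x∋r' , ¬r'Ci') →
          r · r' , ·-closed x x∋r x∋r' ,
          [ (λ c → ¬rCi (C2 c (x∧y≤x r r') ≤-refl)) , (λ c → ¬r'Ci' (C2 c (x∧y≤y r r') ≤-refl)) ] ∘ C3
      ; has-𝟘       = 𝟙 , has-𝟙 x , λ 𝟙C𝟘 → proj₂ (C1 𝟙C𝟘) refl
      }

    Δ-≪-isIdeal : IsIdeal Δ-≪
    Δ-≪-isIdeal = record
      { down-closed = λ (t , x∌t , i≪t) i'≤i → t , x∌t , ≪4 i'≤i i≪t ≤-refl
      ; +-closed    = λ (t , x∌t , i≪t) (t' , x∌t' , i'≪t') →
          t + t' , [ x∌t , x∌t' ] ∘ prime x ,
          ≪5 (≪4 ≤-refl i≪t (x≤x∨y t t')) (≪4 ≤-refl i'≪t' (y≤x∨y t t'))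
      ; has-𝟘       = 𝟘 , proper x , ≪1
      }

    Separable : D → D → Set
    Separable e₀ e = ∀ {f₁ f₂ i₁ i₂} → Γ-Ĉ f₁ → Γ-≪ f₂ → Δ-C i₁ → Δ-≪ i₂ →
                     ¬ (e₀ · f₂ · f₁ ≤ i₂ + (i₁ + e))

    linked-extension : ∀ {e₀ e} → Separable e₀ e → ∃ λ y → Linked x y × y ∋ e₀ × ¬ y ∋ e
    linked-extension {e₀} {e} separable = filter , linked , extends e₀∈F , λ y∋e → avoids y∋e e∈I
      where
      F = ↑ e₀ ∨ᶠ Γ-≪ ∨ᶠ Γ-Ĉ
      I = Δ-≪ ∨ⁱ (Δ-C ∨ⁱ ↓ e)
      F₀-filter = ∨ᶠ-isFilter (↑-isFilter e₀) Γ-≪-isFilter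
      F-filter = ∨ᶠ-isFilter F₀-filter Γ-Ĉ-isFilter
      I₀-ideal = ∨ⁱ-isIdeal Δ-C-isIdeal (↓-isIdeal e)
      I-ideal = ∨ⁱ-isIdeal Δ-≪-isIdeal I₀-ideal

      disjoint : ∀ {d} → F d → ¬ I d
      disjoint {d} (g , f₁ , (g₀ , f₂ , e₀≤g₀ , γ₂ , g₀f₂≤g) , γ₁ , gf₁≤d)
               (i₂ , j , δ₂ , (i₁ , j₀ , δ₁ , j₀≤e , j≤i₁j₀) , d≤i₂j) =
        separable γ₁ γ₂ δ₁ δ₂ (begin
          e₀ · f₂ · f₁   ≤⟨ ∧-monotonic (∧-monotonic e₀≤g₀ ≤-refl) ≤-refl ⟩
          g₀ · f₂ · f₁   ≤⟨ ∧-monotonic g₀f₂≤g ≤-refl ⟩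
          g · f₁         ≤⟨ gf₁≤d ⟩
          d              ≤⟨ d≤i₂j ⟩
          i₂ + j         ≤⟨ ∨-monotonic ≤-refl (≤-trans j≤i₁j₀ (∨-monotonic ≤-refl j₀≤e)) ⟩
          i₂ + (i₁ + e)  ∎)
        where open ≤-Reasoning

      open PrimeSeparator (prime-filter-theorem F-filter I-ideal disjoint)

      e₀∈F : F e₀
      e₀∈F = ∨ᶠ-inj₁ F₀-filter Γ-Ĉ-isFilter (∨ᶠ-inj₁ (↑-isFilter e₀) Γ-≪-isFilter ≤-refl)

      e∈I : I e
      e∈I = ∨ⁱ-inj₂ Δ-≪-isIdeal I₀-ideal (∨ⁱ-inj₂ Δ-C-isIdeal (↓-isIdeal e) ≤-refl)

      linked : Linked x filter
      linked = record
        { C-link  = λ {a} x∋a y∋b → dne λ ¬aCb →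
            avoids y∋b (∨ⁱ-inj₂ Δ-≪-isIdeal I₀-ideal
                          (∨ⁱ-inj₁ Δ-C-isIdeal (↓-isIdeal e) (a , x∋a , ¬aCb)))
        ; Ĉ-link  = λ {a} x∌a y∌b → dne λ ¬aĈb →
            y∌b (extends (∨ᶠ-inj₂ F₀-filter Γ-Ĉ-isFilter (a , x∌a , ¬aĈb)))
        ; ≪-forth = λ {a} a≪b x∋a →
            extends (∨ᶠ-inj₁ F₀-filter Γ-Ĉ-isFilter
                       (∨ᶠ-inj₂ (↑-isFilter e₀) Γ-≪-isFilter (a , x∋a , a≪b)))
        ; ≪-back  = λ {_} {b} a≪b y∋a → dne λ x∌b →
            avoids y∋a (∨ⁱ-inj₁ Δ-≪-isIdeal I₀-ideal (b , x∌b , a≪b))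
        }

  module _ {F I : Pred D 0ℓ} (I-ideal : IsIdeal I) (S : PrimeSeparator F I) where
    open PrimeSeparator S
    open IsIdeal I-ideal

    -- Maximality of the separator turns p ∉ x and t ∉ x into conditions on one element c ∈ x.
    separable-by : ∀ {e₀ e} →
      (∀ {c p t f₁ f₂ i₁ i₂} → ¬ I c → ¬ p Ĉ f₁ → c ≪ f₂ → ¬ c C i₁ → i₂ ≪ t →
         I (c · p) → I (c · t) → e₀ · f₂ · f₁ ≤ i₂ + (i₁ + e) → ⊥) →
      Separable filter e₀ e
    separable-by core (p , x∌p , ¬pĈf₁) (q , x∋q , q≪f₂) (r , x∋r , ¬rCi₁) (t , x∌t , i₂≪t) bound
      with maximal x∌p | maximal x∌t
    ... | r₁ , x∋r₁ , I[r₁p] | r₂ , x∋r₂ , I[r₂t] =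
      core (avoids x∋c) ¬pĈf₁ (≪4 c≤q q≪f₂ ≤-refl) (λ cCi₁ → ¬rCi₁ (C2 cCi₁ c≤r ≤-refl)) i₂≪t
           (down-closed I[r₁p] (∧-monotonic c≤r₁ ≤-refl))
           (down-closed I[r₂t] (∧-monotonic c≤r₂ ≤-refl))
           bound
      where
      c = (q · r) · (r₁ · r₂)
      x∋c : filter ∋ c
      x∋c = ·-closed filter (·-closed filter x∋q x∋r) (·-closed filter x∋r₁ x∋r₂)
      c≤q : c ≤ q
      c≤q = ≤-trans (x∧y≤x _ _) (x∧y≤x q r)
      c≤r : c ≤ r
      c≤r = ≤-trans (x∧y≤x _ _) (x∧y≤y q r)
      c≤r₁ : c ≤ r₁
      c≤r₁ = ≤-trans (x∧y≤y _ _) (x∧y≤x r₁ r₂)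
      c≤r₂ : c ≤ r₂
      c≤r₂ = ≤-trans (x∧y≤y _ _) (x∧y≤y r₁ r₂)

  ¬C-isIdeal : ∀ b → IsIdeal (λ r → ¬ r C b)
  ¬C-isIdeal b = record
    { down-closed = λ ¬rCb r'≤r r'Cb → ¬rCb (C2 r'Cb r'≤r ≤-refl)
    ; +-closed    = λ ¬rCb ¬r'Cb r+r'Cb → [ ¬rCb ∘ C4 , ¬r'Cb ∘ C4 ] (C3 (C4 r+r'Cb))
    ; has-𝟘       = λ 𝟘Cb → proj₁ (C1 𝟘Cb) refl
    }

  ≪-isIdeal : ∀ b → IsIdeal (_≪ b)
  ≪-isIdeal b = record
    { down-closed = λ r≪b r'≤r → ≪4 r'≤r r≪b ≤-refl
    ; +-closed    = ≪5
    ; has-𝟘       = ≪4 ≤-refl ≪1 (𝟘-least b)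
    }

  contact-witness : ∀ {a b} → a C b → ∃₂ λ x y → Linked x y × x ∋ a × y ∋ b
  contact-witness {a} {b} aCb =
    let y , linked , y∋b , _ = linked-extension filter (separable-by (¬C-isIdeal b) S core)
    in filter , y , linked , extends ≤-refl , y∋b
    where
    S = prime-filter-theorem (↑-isFilter a) (¬C-isIdeal b) (λ a≤r ¬rCb → ¬rCb (C2 aCb a≤r ≤-refl))
    open PrimeSeparator S
    core : ∀ {c p t f₁ f₂ i₁ i₂} → ¬ ¬ c C b → ¬ p Ĉ f₁ → c ≪ f₂ → ¬ c C i₁ → i₂ ≪ t →
           ¬ (c · p) C b → ¬ (c · t) C b → b · f₂ · f₁ ≤ i₂ + (i₁ + 𝟘) → ⊥
    core ¬¬cCb ¬pĈf₁ c≪f₂ ¬cCi₁ i₂≪t ¬cp-C-b ¬ct-C-b bound =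
      ¬pĈf₁ (Ĉ-core (dne ¬¬cCb) c≪f₂ ¬cp-C-b ¬ct-C-b ¬cCi₁ i₂≪t
                    (≤-trans bound (∨-monotonic ≤-refl (+𝟘-≤ _))))

  ≪-witness : ∀ {a b} → ¬ a ≪ b → ∃₂ λ x y → Linked x y × x ∋ a × ¬ y ∋ b
  ≪-witness {a} {b} a≪̸b =
    let y , linked , _ , y∌b = linked-extension filter (separable-by (≪-isIdeal b) S core)
    in filter , y , linked , extends ≤-refl , y∌b
    where
    S = prime-filter-theorem (↑-isFilter a) (≪-isIdeal b) (λ a≤r r≪b → a≪̸b (≪4 a≤r r≪b ≤-refl))
    open PrimeSeparator S
    core : ∀ {c p t f₁ f₂ i₁ i₂} → ¬ c ≪ b → ¬ p Ĉ f₁ → c ≪ f₂ → ¬ c C i₁ → i₂ ≪ t →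
           c · p ≪ b → c · t ≪ b → 𝟙 · f₂ · f₁ ≤ i₂ + (i₁ + b) → ⊥
    core c≪̸b ¬pĈf₁ c≪f₂ ¬cCi₁ i₂≪t cp≪b ct≪b bound =
      c≪̸b (≪-core ¬pĈf₁ c≪f₂ cp≪b ct≪b ¬cCi₁ i₂≪t
                  (≤-trans (∧-monotonic (≤𝟙· _) ≤-refl) bound))

  separation : ∀ {a b} → ¬ a ≤ b → ∃ λ x → x ∋ a × ¬ x ∋ b
  separation {a} {b} a≰b = filter , extends ≤-refl , λ x∋b → avoids x∋b ≤-refl
    where
    open PrimeSeparator
      (prime-filter-theorem (↑-isFilter a) (↓-isIdeal b) (λ a≤r r≤b → a≰b (≤-trans a≤r r≤b)))

  ≤-by-primeFilters : ∀ {a b} → (∀ {x} → x ∋ a → x ∋ b) → a ≤ b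
  ≤-by-primeFilters ∋a⇒∋b = dne λ a≰b → let x , x∋a , x∌b = separation a≰b in x∌b (∋a⇒∋b {x} x∋a)

-- Every EDC-lattice axiom has its order dual among the axioms.
dual : EDCLattice → EDCLattice
dual L = record
  { D = D ; _≤_ = flip _≤_ ; 𝟘 = 𝟙 ; 𝟙 = 𝟘 ; _+_ = _·_ ; _·_ = _+_
  ; _C_ = _Ĉ_ ; _Ĉ_ = _C_ ; _≪_ = flip _≪_
  ; isDistributiveLattice = AlgDistributiveLatticeProperties.∧-∨-isDistributiveLattice algebraic
  ; ≤⇒+ = y≤x⇒x∧y≈y
  ; +⇒≤ = λ {a} a·b≡b → subst (_≤ a) a·b≡b (x∧y≤x a _)
  ; 𝟘-least = 𝟙-greatest ; 𝟙-greatest = 𝟘-least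
  ; C1 = Ĉ1 ; C2 = Ĉ2 ; C3 = Ĉ3 ; C4 = Ĉ4 ; C5 = Ĉ5
  ; Ĉ1 = C1 ; Ĉ2 = C2 ; Ĉ3 = C3 ; Ĉ4 = C4 ; Ĉ5 = C5
  ; ≪1 = ≪2 ; ≪2 = ≪1 ; ≪3 = ≪3 ; ≪5 = ≪6 ; ≪6 = ≪5
  ; ≪4 = λ a≤a' b≪a b'≤b → ≪4 b'≤b b≪a a≤a'
  ; ≪7 = λ b≪a d≪b·c a·d≪c → ≪7 b≪a a·d≪c d≪b·c
  ; MC1 = MĈ1 ; MC2 = MĈ2 ; MĈ1 = MC1 ; MĈ2 = MC2
  ; M≪1 = M≪2 ; M≪2 = M≪1
  }
  where
  open EDCLattice L
  open LatticeOrder L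
  algebraic : AlgBundles.DistributiveLattice 0ℓ 0ℓ
  algebraic = record
    { Carrier = D ; _≈_ = _≡_ ; _∨_ = _+_ ; _∧_ = _·_ ; isDistributiveLattice = isDistributiveLattice }

module Duality (em₀ : ExcludedMiddle 0ℓ) (em₁ : ExcludedMiddle (lsuc 0ℓ))
               (zorn : Zorn (lsuc 0ℓ)) (L : EDCLattice) where
  open EDCLattice L
  open Filters L
  open PrimeFilterTheorem em₀ em₁ zorn L using (fromPred)
  open Canonical em₀ em₁ zorn L using (Linked)
  open Classical em₀
  private
    module Fᵈ = Filters (dual L)
    module Canonicalᵈ = Canonical em₀ em₁ zorn (dual L)

  complement-isPrimeFilter : ∀ {P} → Fᵈ.IsPrimeFilter P → IsPrimeFilter (∁ P)
  complement-isPrimeFilter {P} isPF = record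
    { isFilter = record
      { up-closed = λ a∉P a≤b Pb → a∉P (Pᵈ.up-closed Pb a≤b)
      ; ·-closed  = λ a∉P b∉P Pab → [ a∉P , b∉P ] (Pᵈ.prime Pab)
      ; has-𝟙     = Pᵈ.proper
      }
    ; proper = λ ¬P𝟘 → ¬P𝟘 Pᵈ.has-𝟙
    ; prime  = ∁-prime
    }
    where
    module Pᵈ = Fᵈ.IsPrimeFilter isPF
    ∁-prime : ∀ {a b} → ¬ P (a + b) → ¬ P a ⊎ ¬ P b
    ∁-prime {a} a+b∉P with em₀ {P a}
    ... | yes Pa = inj₂ λ Pb → a+b∉P (Pᵈ.·-closed Pa Pb)
    ... | no a∉P = inj₁ a∉P

  complement : Fᵈ.PrimeFilter → PrimeFilter
  complement x = fromPred (∁ (x Fᵈ.∋_)) (complement-isPrimeFilter (Fᵈ.PrimeFilter.isPrimeFilter x))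

  complement-linked : ∀ {x y} → Canonicalᵈ.Linked x y → Linked (complement x) (complement y)
  complement-linked linked = record
    { C-link  = λ x̄∋a ȳ∋b → Ĉ-link (decide-sound x̄∋a) (decide-sound ȳ∋b)
    ; Ĉ-link  = λ x̄∌a ȳ∌b → C-link (dne (x̄∌a ∘ decide-complete)) (dne (ȳ∌b ∘ decide-complete))
    ; ≪-forth = λ a≪b x̄∋a → decide-complete λ y∋b → decide-sound x̄∋a (≪-back a≪b y∋b)
    ; ≪-back  = λ a≪b ȳ∋a → decide-complete λ x∋b → decide-sound ȳ∋a (≪-forth a≪b x∋b)
    }
    where open Canonicalᵈ.Linked linked

  Ĉ-witness : ∀ {a b} → a Ĉ b → ∃₂ λ x y → Linked x y × ¬ x ∋ a × ¬ y ∋ b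
  Ĉ-witness aĈb =
    let x , y , linked , x∋a , y∋b = Canonicalᵈ.contact-witness aĈb
    in complement x , complement y , complement-linked linked ,
       (λ x̄∋a → decide-sound x̄∋a x∋a) , (λ ȳ∋b → decide-sound ȳ∋b y∋b)

module InteriorClosure (em₀ : ExcludedMiddle 0ℓ) {X : Set} (τ : Topology X) where
  open Topology τ
  open Classical em₀

  module _ {A B : Pred X 0ℓ} where
    Int-mono : A ⊆ B → Int A ⊆ Int B
    Int-mono A⊆B (o , x∈o , o⊆A) = o , x∈o , λ y∈o → A⊆B (o⊆A y∈o)

    Cl-mono : A ⊆ B → Cl A ⊆ Cl B
    Cl-mono A⊆B x∈ClA o x∈o = let y , y∈o , Ay = x∈ClA o x∈o in y , y∈o , A⊆B Ay

    Int-∩ : Int A ∩ Int B ⊆ Int (A ∩ B)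
    Int-∩ ((o , x∈o , o⊆A) , (o' , x∈o' , o'⊆B)) =
      let o∩o' , o∩o'≐ = ∩-open o o'
      in o∩o' , proj₂ o∩o'≐ (x∈o , x∈o') ,
         λ y∈o∩o' → let y∈o , y∈o' = proj₁ o∩o'≐ y∈o∩o' in o⊆A y∈o , o'⊆B y∈o'

    Cl-∪ : Cl (A ∪ B) ⊆ Cl A ∪ Cl B
    Cl-∪ {x} x∈Cl with em₀ {Cl A x} | em₀ {Cl B x}
    ... | yes x∈ClA | _ = inj₁ x∈ClA
    ... | no _ | yes x∈ClB = inj₂ x∈ClB
    ... | no x∉ClA | no x∉ClB =
      let o , x∈o , o∩A≡∅ = separating-open x∉ClA
          o' , x∈o' , o'∩B≡∅ = separating-open x∉ClB
          o∩o' , o∩o'≐ = ∩-open o o'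
          y , y∈o∩o' , A∪By = x∈Cl o∩o' (proj₂ o∩o'≐ (x∈o , x∈o'))
          y∈o , y∈o' = proj₁ o∩o'≐ y∈o∩o'
      in ⊥-elim ([ o∩A≡∅ y∈o , o'∩B≡∅ y∈o' ] A∪By)
      where
      separating-open : ∀ {E} → ¬ Cl E x → ∃ λ o → ⟦ o ⟧ x × (∀ {y} → ⟦ o ⟧ y → ¬ E y)
      separating-open x∉ClE = dne λ none → x∉ClE λ o x∈o →
        dne λ misses → none (o , x∈o , λ {y} y∈o Ey → misses (y , y∈o , Ey))

  module _ {A : Pred X 0ℓ} where
    Int⊆ : Int A ⊆ A
    Int⊆ (o , x∈o , o⊆A) = o⊆A x∈o

    ⊆Cl : A ⊆ Cl A
    ⊆Cl Ax o x∈o = _ , x∈o , Ax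

    Int-idem : Int A ⊆ Int (Int A)
    Int-idem (o , x∈o , o⊆A) = o , x∈o , λ y∈o → o , y∈o , o⊆A

    Cl-idem : Cl (Cl A) ⊆ Cl A
    Cl-idem x∈ClClA o x∈o = let y , y∈o , y∈ClA = x∈ClClA o x∈o in y∈ClA o y∈o

  regularClosed⇒closed : ∀ {A} → RegularClosed A → Cl A ⊆ A
  regularClosed⇒closed (A⊆ClIntA , ClIntA⊆A) x∈ClA = ClIntA⊆A (Cl-idem (Cl-mono A⊆ClIntA x∈ClA))

  U⊆Int-U : U ⊆ Int U
  U⊆Int-U _ = let o , o≐U = U-open in o , proj₂ o≐U tt , λ _ → tt

  -- Int and Cl are mutually inverse between RC(X) and RO(X).
  RC⇒RO : ∀ {L} → EmbeddingRC L τ → EmbeddingRO L τ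
  RC⇒RO {L} embedding = record
    { h           = λ a → Int (h a)
    ; h-regular   = λ a → Int-mono (proj₁ (h-regular a)) , Int-mono (proj₂ (h-regular a))
    ; h-injective = λ a b (ga⊆gb , gb⊆ga) → h-injective a b (⊆-by-Int ga⊆gb , ⊆-by-Int gb⊆ga)
    ; h-𝟘         = (λ x∈g𝟘 → proj₁ h-𝟘 (Int⊆ x∈g𝟘)) , λ ()
    ; h-𝟙         = (λ _ → tt) , λ _ → Int-mono (proj₂ h-𝟙) (U⊆Int-U tt)
    ; h-+         = λ a b → Int-mono (proj₁ (h-+-Int a b)) , Int-mono (proj₂ (h-+-Int a b))
    ; h-·         = λ a b →
        (λ x∈g[ab] → let x∈Int[ha∩hb] = Int-mono Cl-Int-∩⊆ (Int-mono (proj₁ (h-· a b)) x∈g[ab])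
                     in Int-mono proj₁ x∈Int[ha∩hb] , Int-mono proj₂ x∈Int[ha∩hb]) ,
        (λ x∈ga∩gb → Int-mono (proj₂ (h-· a b)) (Int-mono ⊆Cl (Int-idem (Int-∩ x∈ga∩gb))))
    ; h-C⇒        = λ a b aCb ∅≐ → h-C⇒ a b aCb (≐-trans (≐-sym (Cl-Int-∩≐ a b)) ∅≐)
    ; h-C⇐        = λ a b ≢∅ → h-C⇐ a b λ ∅≐ → ≢∅ (≐-trans (Cl-Int-∩≐ a b) ∅≐)
    ; h-Ĉ⇒        = h-Ĉ⇒
    ; h-Ĉ⇐        = h-Ĉ⇐
    ; h-≪⇒        = λ a b a≪b x∈ClIntha → h-≪⇒ a b a≪b (proj₂ (h-regular a) x∈ClIntha)
    ; h-≪⇐        = λ a b Cl-ga⊆gb → h-≪⇐ a b λ x∈ha → Cl-ga⊆gb (proj₁ (h-regular a) x∈ha)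
    }
    where
    open EDCLattice L using (_+_)
    open EmbeddingRC embedding

    ⊆-by-Int : ∀ {a b} → Int (h a) ⊆ Int (h b) → h a ⊆ h b
    ⊆-by-Int {a} {b} Int⊆Int x∈ha = proj₂ (h-regular b) (Cl-mono Int⊆Int (proj₁ (h-regular a) x∈ha))

    h-+-Int : ∀ a b → h (a + b) ≐ Cl (Int (h a) ∪ Int (h b))
    h-+-Int a b =
      (λ x∈h[a+b] → [ Cl-mono inj₁ ∘ proj₁ (h-regular a) , Cl-mono inj₂ ∘ proj₁ (h-regular b) ]
                      (proj₁ (h-+ a b) x∈h[a+b])) ,
      (λ x∈Cl → proj₂ (h-+ a b) (Sum.map (proj₂ (h-regular a)) (proj₂ (h-regular b)) (Cl-∪ x∈Cl)))

    Cl-Int-∩⊆ : ∀ {a b} → Cl (Int (h a ∩ h b)) ⊆ h a ∩ h b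
    Cl-Int-∩⊆ {a} {b} x∈Cl =
      regularClosed⇒closed (h-regular a) (Cl-mono (λ y∈Int → proj₁ (Int⊆ y∈Int)) x∈Cl) ,
      regularClosed⇒closed (h-regular b) (Cl-mono (λ y∈Int → proj₂ (Int⊆ y∈Int)) x∈Cl)

    Cl-Int-∩≐ : ∀ a b → (Cl (Int (h a)) ∩ Cl (Int (h b))) ≐ (h a ∩ h b)
    Cl-Int-∩≐ a b = (λ (x , y) → proj₂ (h-regular a) x , proj₂ (h-regular b) y) ,
                    (λ (x , y) → proj₁ (h-regular a) x , proj₁ (h-regular b) y)

module Alexandrov (em₀ : ExcludedMiddle 0ℓ) {X : Set} (_≼_ : X → X → Set)
                  (≼-refl : ∀ {z} → z ≼ z) (≼-trans : ∀ {z w v} → z ≼ w → w ≼ v → z ≼ v) where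
  open Classical em₀

  IsUpSet : Pred (X → Bool) 0ℓ
  IsUpSet o = ∀ {z w} → z ≼ w → T (o z) → T (o w)

  upSetTopology : Topology X
  upSetTopology = record
    { Open   = Σ (X → Bool) IsUpSet
    ; ⟦_⟧    = λ (o , _) z → T (o z)
    ; ⋃-open = λ I f →
        ((λ z → decide (∃ λ i → T (proj₁ (f i) z))) ,
         λ z≼w z∈⋃ → let i , z∈fi = decide-sound z∈⋃ in decide-complete (i , proj₂ (f i) z≼w z∈fi)) ,
        decide-sound , decide-complete
    ; ∩-open = λ (o , o-up) (o' , o'-up) →
        ((λ z → o z ∧ o' z) ,
         λ z≼w z∈o∩o' → let z∈o , z∈o' = Equivalence.to T-∧ z∈o∩o'
                        in Equivalence.from T-∧ (o-up z≼w z∈o , o'-up z≼w z∈o')) ,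
        Equivalence.to T-∧ , Equivalence.from T-∧
    ; U-open = ((λ _ → true) , λ _ _ → tt) , (λ _ → tt) , λ _ → tt
    }

  open Topology upSetTopology

  Int⇒ : ∀ {A z} → Int A z → ∀ {w} → z ≼ w → A w
  Int⇒ ((o , o-up) , z∈o , o⊆A) z≼w = o⊆A (o-up z≼w z∈o)

  ⇒Int : ∀ {A z} → (∀ {w} → z ≼ w → A w) → Int A z
  ⇒Int {A} ↑z⊆A =
    ((λ w → decide (∀ v → w ≼ v → A v)) ,
     λ w≼w' w∈o → decide-complete λ v w'≼v → decide-sound w∈o v (≼-trans w≼w' w'≼v)) ,
    decide-complete (λ _ → ↑z⊆A) , λ {w} w∈o → decide-sound w∈o w ≼-refl

  Cl⇒ : ∀ {A z} → Cl A z → ∃ λ w → z ≼ w × A w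
  Cl⇒ {A} {z} z∈ClA =
    let w , w∈↑z , Aw = z∈ClA ↑z (decide-complete ≼-refl) in w , decide-sound w∈↑z , Aw
    where
    ↑z : Topology.Open upSetTopology
    ↑z = (λ w → decide (z ≼ w)) , λ w≼w' z≼w → decide-complete (≼-trans (decide-sound z≼w) w≼w')

  ⇒Cl : ∀ {A z} → (∃ λ w → z ≼ w × A w) → Cl A z
  ⇒Cl (w , z≼w , Aw) (o , o-up) z∈o = w , o-up z≼w z∈o , Aw

module CanonicalSpace (em₀ : ExcludedMiddle 0ℓ) (em₁ : ExcludedMiddle (lsuc 0ℓ))
                      (zorn : Zorn (lsuc 0ℓ)) (L : EDCLattice) where
  open EDCLattice L
  open LatticeOrder L
  open Filters L
  open Canonical em₀ em₁ zorn L
  open Duality em₀ em₁ zorn L using (Ĉ-witness)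
  open Classical em₀

  data Point : Set where
    point : PrimeFilter → Point
    edge  : (x y : PrimeFilter) → Linked x y → Point

  -- The smallest open set around  edge x y r  is {edge x y r, point x, point y}.
  data _≼_ : Point → Point → Set where
    ≼-refl : ∀ {z} → z ≼ z
    edge≼ˡ : ∀ {x y r} → edge x y r ≼ point x
    edge≼ʳ : ∀ {x y r} → edge x y r ≼ point y

  ≼-trans : ∀ {z w v} → z ≼ w → w ≼ v → z ≼ v
  ≼-trans ≼-refl w≼v = w≼v
  ≼-trans z≼w ≼-refl = z≼w

  open Alexandrov em₀ _≼_ ≼-refl ≼-trans public using (upSetTopology)
  open Alexandrov em₀ _≼_ ≼-refl ≼-trans using (Int⇒; ⇒Int; Cl⇒; ⇒Cl)
  open Topology upSetTopology using (Int; Cl)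
  open InteriorClosure em₀ upSetTopology using (Int-mono; Cl-mono; Int-∩)

  Some Every : Pred PrimeFilter 0ℓ → Pred Point 0ℓ
  Some P (point x)    = P x
  Some P (edge x y _) = P x ⊎ P y
  Every P (point x)    = P x
  Every P (edge x y _) = P x × P y

  module _ {P Q : Pred PrimeFilter 0ℓ} (P⊆Q : ∀ {x} → P x → Q x) where
    Some-mono : Some P ⊆ Some Q
    Some-mono {point _}      = P⊆Q
    Some-mono {edge _ _ _}   = Sum.map P⊆Q P⊆Q

    Every-mono : Every P ⊆ Every Q
    Every-mono {point _}     = P⊆Q
    Every-mono {edge _ _ _}  = Product.map P⊆Q P⊆Q

  module _ {P : Pred PrimeFilter 0ℓ} where
    Every⇒Some-↑ : ∀ {z w} → Every P z → z ≼ w → Some P w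
    Every⇒Some-↑ {point _}      Px        ≼-refl = Px
    Every⇒Some-↑ {edge _ _ _}   (Px , _)  ≼-refl = inj₁ Px
    Every⇒Some-↑                (Px , _)  edge≼ˡ = Px
    Every⇒Some-↑                (_ , Py)  edge≼ʳ = Py

    Every⇒Some-↓ : ∀ {z w} → z ≼ w → Every P w → Some P z
    Every⇒Some-↓ {point _}    ≼-refl Px       = Px
    Every⇒Some-↓ {edge _ _ _} ≼-refl (Px , _) = inj₁ Px
    Every⇒Some-↓              edge≼ˡ Px       = inj₁ Px
    Every⇒Some-↓              edge≼ʳ Py       = inj₂ Py

    Some-none : (∀ x → ¬ P x) → ∀ z → ¬ Some P z
    Some-none ¬P (point x)    = ¬P x
    Some-none ¬P (edge x y _) = [ ¬P x , ¬P y ]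

    Some-all : (∀ x → P x) → ∀ z → Some P z
    Some-all allP (point x)    = allP x
    Some-all allP (edge x _ _) = inj₁ (allP x)

  module _ (P : Pred PrimeFilter 0ℓ) where
    Int-Some : Int (Some P) ≐ Every P
    Int-Some = Int⊆Every , λ z∈Every → ⇒Int (Every⇒Some-↑ z∈Every)
      where
      Int⊆Every : Int (Some P) ⊆ Every P
      Int⊆Every {point _}    z∈Int = Int⇒ z∈Int ≼-refl
      Int⊆Every {edge _ _ _} z∈Int = Int⇒ z∈Int edge≼ˡ , Int⇒ z∈Int edge≼ʳ

    Cl-Every : Cl (Every P) ≐ Some P
    Cl-Every = (λ z∈Cl → let _ , z≼w , w∈Every = Cl⇒ z∈Cl in Every⇒Some-↓ z≼w w∈Every) , Some⊆Cl
      where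
      Some⊆Cl : Some P ⊆ Cl (Every P)
      Some⊆Cl {point x}    Px        = ⇒Cl (point x , ≼-refl , Px)
      Some⊆Cl {edge x _ _} (inj₁ Px) = ⇒Cl (point x , edge≼ˡ , Px)
      Some⊆Cl {edge _ y _} (inj₂ Py) = ⇒Cl (point y , edge≼ʳ , Py)

    Cl-Int-Some : Cl (Int (Some P)) ≐ Some P
    Cl-Int-Some = (proj₁ Cl-Every ∘ Cl-mono (proj₁ Int-Some)) , (Cl-mono (proj₂ Int-Some) ∘ proj₂ Cl-Every)

    ¬Every⇒Some∁ : ∀ {z} → ¬ Every P z → Some (∁ P) z
    ¬Every⇒Some∁ {point _} x∉P = x∉P
    ¬Every⇒Some∁ {edge x _ _} ¬[Px×Py] with em₀ {P x}
    ... | yes Px    = inj₂ λ Py → ¬[Px×Py] (Px , Py)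
    ... | no x∉P    = inj₁ x∉P

  Some-C : ∀ {a b z} → Some (_∋ a) z → Some (_∋ b) z → a C b
  Some-C {z = point x}    x∋a        x∋b        = ∋⇒C x x∋a x∋b
  Some-C {z = edge x _ _} (inj₁ x∋a) (inj₁ x∋b) = ∋⇒C x x∋a x∋b
  Some-C {z = edge _ _ r} (inj₁ x∋a) (inj₂ y∋b) = Linked.C-link r x∋a y∋b
  Some-C {z = edge _ _ r} (inj₂ y∋a) (inj₁ x∋b) = C4 (Linked.C-link r x∋b y∋a)
  Some-C {z = edge _ y _} (inj₂ y∋a) (inj₂ y∋b) = ∋⇒C y y∋a y∋b

  Some∌-Ĉ : ∀ {a b z} → Some (∁ (_∋ a)) z → Some (∁ (_∋ b)) z → a Ĉ b
  Some∌-Ĉ {z = point x}    x∌a        x∌b        = ∌⇒Ĉ x x∌a x∌b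
  Some∌-Ĉ {z = edge x _ _} (inj₁ x∌a) (inj₁ x∌b) = ∌⇒Ĉ x x∌a x∌b
  Some∌-Ĉ {z = edge _ _ r} (inj₁ x∌a) (inj₂ y∌b) = Linked.Ĉ-link r x∌a y∌b
  Some∌-Ĉ {z = edge _ _ r} (inj₂ y∌a) (inj₁ x∌b) = Ĉ4 (Linked.Ĉ-link r x∌b y∌a)
  Some∌-Ĉ {z = edge _ y _} (inj₂ y∌a) (inj₂ y∌b) = ∌⇒Ĉ y y∌a y∌b

  Every-cover : ∀ {a b} → ¬ a Ĉ b → ∀ z → Every (_∋ a) z ⊎ Every (_∋ b) z
  Every-cover {a} {b} ¬aĈb z with em₀ {Every (_∋ a) z} | em₀ {Every (_∋ b) z}
  ... | yes z∈a | _       = inj₁ z∈a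
  ... | no _    | yes z∈b = inj₂ z∈b
  ... | no z∉a  | no z∉b  =
    ⊥-elim (¬aĈb (Some∌-Ĉ {a} {b} {z} (¬Every⇒Some∁ (_∋ a) {z} z∉a) (¬Every⇒Some∁ (_∋ b) {z} z∉b)))

  Some⇒Every : ∀ {a b} → a ≪ b → Some (_∋ a) ⊆ Every (_∋ b)
  Some⇒Every a≪b {point x}    x∋a        = up-closed x x∋a (≪3 a≪b)
  Some⇒Every a≪b {edge x _ r} (inj₁ x∋a) = up-closed x x∋a (≪3 a≪b) , Linked.≪-forth r a≪b x∋a
  Some⇒Every a≪b {edge _ y r} (inj₂ y∋a) = Linked.≪-back r a≪b y∋a , up-closed y y∋a (≪3 a≪b)

  h : D → Pred Point 0ℓ
  h a = Some (_∋ a)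

  Int-h-∩ : ∀ a b → Int (h a ∩ h b) ≐ Every (_∋ a · b)
  Int-h-∩ a b =
    (λ {z} z∈Int → Every-∩ {z} (proj₁ (Int-Some (_∋ a)) (Int-mono proj₁ z∈Int))
                              (proj₁ (Int-Some (_∋ b)) (Int-mono proj₂ z∈Int))) ,
    (λ {z} z∈Every → Int-∩ (proj₂ (Int-Some (_∋ a)) (Every-mono (λ {x} → proj₁ ∘ ∋-· x) {z} z∈Every) ,
                            proj₂ (Int-Some (_∋ b)) (Every-mono (λ {x} → proj₂ ∘ ∋-· x) {z} z∈Every)))
    where
    Every-∩ : ∀ {z} → Every (_∋ a) z → Every (_∋ b) z → Every (_∋ a · b) z
    Every-∩ {point x}    x∋a         x∋b         = ·-closed x x∋a x∋b
    Every-∩ {edge x y _} (x∋a , y∋a) (x∋b , y∋b) = ·-closed x x∋a x∋b , ·-closed y y∋a y∋b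

  embeddingRC : EmbeddingRC L upSetTopology
  embeddingRC = record
    { h           = h
    ; h-regular   = λ a → ≐-sym (Cl-Int-Some (_∋ a))
    ; h-injective = λ a b (ha⊆hb , hb⊆ha) →
        ≤-antisym (≤-by-primeFilters λ {x} → ha⊆hb {point x}) (≤-by-primeFilters λ {x} → hb⊆ha {point x})
    ; h-𝟘         = (λ {z} → Some-none (λ x → proper x) z) , λ ()
    ; h-𝟙         = (λ _ → tt) , λ {z} _ → Some-all (λ x → has-𝟙 x) z
    ; h-+         = λ a b →
        (λ {z} z∈h[a+b] → Some-∪ {a} {b} {z} (Some-mono (λ {x} → prime x) {z} z∈h[a+b])) ,
        λ {z} → [ Some-mono (λ {x} x∋a → up-closed x x∋a (x≤x∨y a b)) {z}
                , Some-mono (λ {x} x∋b → up-closed x x∋b (y≤x∨y a b)) {z} ]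
    ; h-·         = λ a b → ≐-trans (≐-sym (Cl-Every (_∋ a · b)))
                                (Cl-mono (proj₂ (Int-h-∩ a b)) , Cl-mono (proj₁ (Int-h-∩ a b)))
    ; h-C⇒        = λ a b aCb (∩⊆∅ , _) →
        let x , y , r , x∋a , y∋b = contact-witness aCb in ∩⊆∅ {edge x y r} (inj₁ x∋a , inj₂ y∋b)
    ; h-C⇐        = λ a b ∩≢∅ → dne λ ¬aCb →
        ∩≢∅ ((λ {z} (z∈ha , z∈hb) → ¬aCb (Some-C {a} {b} {z} z∈ha z∈hb)) , λ ())
    ; h-Ĉ⇒        = λ a b aĈb (_ , U⊆) →
        let x , y , r , x∌a , y∌b = Ĉ-witness aĈb
        in [ x∌a ∘ proj₁ ∘ proj₁ (Int-Some (_∋ a)) , y∌b ∘ proj₂ ∘ proj₁ (Int-Some (_∋ b)) ]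
             (U⊆ {edge x y r} tt)
    ; h-Ĉ⇐        = λ a b ∪≢U → dne λ ¬aĈb →
        ∪≢U ((λ _ → tt) ,
             λ {z} _ → Sum.map (proj₂ (Int-Some (_∋ a))) (proj₂ (Int-Some (_∋ b))) (Every-cover ¬aĈb z))
    ; h-≪⇒        = λ a b a≪b {z} z∈ha → proj₂ (Int-Some (_∋ b)) (Some⇒Every a≪b {z} z∈ha)
    ; h-≪⇐        = λ a b ha⊆Int-hb → dne λ a≪̸b →
        let x , y , r , x∋a , y∌b = ≪-witness a≪̸b
        in y∌b (proj₂ (proj₁ (Int-Some (_∋ b)) (ha⊆Int-hb {edge x y r} (inj₁ x∋a))))
    }
    where
    Some-∪ : ∀ {a b z} → Some (λ x → x ∋ a ⊎ x ∋ b) z → (h a ∪ h b) z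
    Some-∪ {z = point _}    = id
    Some-∪ {z = edge _ _ _} = [ Sum.map inj₁ inj₁ , Sum.map inj₂ inj₂ ]

mainTheorem4 : ExcludedMiddle 0ℓ → ExcludedMiddle (lsuc 0ℓ) → Zorn (lsuc 0ℓ) →
    (L : EDCLattice) →
      Σ Set (λ X → Σ (Topology X) (λ τ → EmbeddingRC L τ))
      × Σ Set (λ Y → Σ (Topology Y) (λ τ → EmbeddingRO L τ))
mainTheorem4 em₀ em₁ zorn L =
  (Point , upSetTopology , embeddingRC) ,
  (Point , upSetTopology , InteriorClosure.RC⇒RO em₀ upSetTopology embeddingRC)
  where open CanonicalSpace em₀ em₁ zorn L
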